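{- Let $U$ be a Milliken-Taylor ultrafilter on $\mathrm{FIN}$ and let $U_{\min,\max}=\{A\subseteq\omega\times\omega:\{x\in\mathrm{FIN}:(\min x,\max x)\in A\}\in U\}$. Then $U_{\min,\max}\equiv_T U_{\min,\max}\cdot U_{\min,\max}$.
   Context: $\mathrm{FIN}=[\omega]^{<\omega}\setminus\{\emptyset\}$. A block sequence is a sequence $\langle x_i\rangle$ in $\mathrm{FIN}$ with $\max(x_i)<\min(x_j)$ for $i<j$; $\mathrm{FIN}^{[\infty]}$ is the set of infinite block sequences. For $X=\langle x_i\rangle\in\mathrm{FIN}^{[\infty]}$, $[X]=\{\bigcup_{i\in F}x_i:F\in\mathrm{FIN}\}$; $X/m=\langle x_i:i\ge n\rangle$ with $n$ least such that $\min(x_n)>m$; $Y\le^*X$ iff $[Y/m]\subseteq[X]$ for some $m$. $U$ is Milliken-Taylor iff (1) every $A\in U$ contains some $[X]\in U$ with $X\in\mathrm{FIN}^{[\infty]}$, and (2) whenever $X_0\ge^*X_1\ge^*\cdots$ in $\mathrm{FIN}^{[\infty]}$ with all $[X_n]\in U$, there is $Y\in\mathrm{FIN}^{[\infty]}$ with $[Y]\in U$ and $X_n\ge^*Y$ for all $n$. For filters $W$ on $X$, $V$ on $Y$, $W\cdot V$ is the filter on $X\times Y$ with $A\in W\cdot V$ iff $\{x:\{y:(x,y)\in A\}\in V\}\in W$. Ultrafilters are ordered by $\supseteq$. $P\le_TQ$ means there is $f:Q\to P$ mapping cofinal subsets of $Q$ to cofinal subsets of $P$; $\equiv_T$ is two-way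 $\le_T$. -}

module Defs where

open import Level using (0ℓ) renaming (suc to lsuc)
open import Data.Nat using (ℕ; _<_; _≤_; _+_)
open import Data.Product using (Σ; ∃-syntax; _×_; _,_; proj₁)
open import Data.Sum using (_⊎_)
open import Data.Unit using (⊤)
open import Data.List.NonEmpty as List⁺ using (List⁺)
open import Data.List.Relation.Unary.Linked using (Linked)
open import Data.List.Membership.Propositional using (_∈_)
open import Relation.Nullary using (¬_)
open import Relation.Unary using (Pred; _⊆_; _∩_; ∁; ∅)
open import Relation.Binary.PropositionalEquality using (_≡_)

-- FIN: nonempty finite subsets of ω, represented canonically as
-- nonempty strictly increasing lists of naturals.

record FIN : Set where
  constructor mkFIN
  field
    elems : List⁺ ℕ
    incr  : Linked _<_ (List⁺.toList elems)

minF : FIN → ℕ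
minF x = List⁺.head (FIN.elems x)

maxF : FIN → ℕ
maxF x = List⁺.last (FIN.elems x)

_∈F_ : ℕ → FIN → Set
n ∈F x = n ∈ List⁺.toList (FIN.elems x)

IsBlock : (ℕ → FIN) → Set
IsBlock X = ∀ i j → i < j → maxF (X i) < minF (X j)

-- [X] = { ⋃_{i ∈ F} x_i : F ∈ FIN }
⟦_⟧ : (ℕ → FIN) → Pred FIN 0ℓ
⟦ X ⟧ s = ∃[ F ] (∀ n → ((n ∈F s → ∃[ i ] (i ∈F F × n ∈F X i))
                        × (∃[ i ] (i ∈F F × n ∈F X i) → n ∈F s)))

shift : (ℕ → FIN) → ℕ → (ℕ → FIN)
shift X n i = X (n + i)

TailStart : (ℕ → FIN) → ℕ → ℕ → Set
TailStart X m n = (m < minF (X n)) × (∀ k → k < n → minF (X k) ≤ m)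

⟦_/_⟧ : (ℕ → FIN) → ℕ → Pred FIN 0ℓ
⟦ X / m ⟧ s = ∃[ n ] (TailStart X m n × ⟦ shift X n ⟧ s)

_≤*_ : (ℕ → FIN) → (ℕ → FIN) → Set
Y ≤* X = ∃[ m ] (⟦ Y / m ⟧ ⊆ ⟦ X ⟧)

Filt : Set → Set₁
Filt X = Pred (Pred X 0ℓ) 0ℓ

record IsUltrafilter {X : Set} (U : Filt X) : Set₁ where
  field
    upward : ∀ {A B : Pred X 0ℓ} → A ⊆ B → U A → U B
    inter  : ∀ {A B : Pred X 0ℓ} → U A → U B → U (A ∩ B)
    full   : U (λ _ → ⊤)
    proper : ¬ U ∅
    ultra  : ∀ (A : Pred X 0ℓ) → U A ⊎ U (∁ A)

MT1 : Filt FIN → Set₁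
MT1 U = ∀ (A : Pred FIN 0ℓ) → U A →
          ∃[ X ] (IsBlock X × ⟦ X ⟧ ⊆ A × U ⟦ X ⟧)

MT2 : Filt FIN → Set
MT2 U = ∀ (Xs : ℕ → ℕ → FIN) →
          (∀ n → IsBlock (Xs n)) →
          (∀ n → Xs (Data.Nat.suc n) ≤* Xs n) →
          (∀ n → U ⟦ Xs n ⟧) →
          ∃[ Y ] (IsBlock Y × U ⟦ Y ⟧ × (∀ n → Y ≤* Xs n))

record IsMillikenTaylor (U : Filt FIN) : Set₁ where
  field
    ultrafilter : IsUltrafilter U
    mt1         : MT1 U
    mt2         : MT2 U

Uminmax : Filt FIN → Filt (ℕ × ℕ)
Uminmax U A = U (λ x → A (minF x , maxF x))

_·_ : {X Y : Set} → Filt X → Filt Y → Filt (X × Y)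
(W · V) A = W (λ x → V (λ y → A (x , y)))

Elt : {X : Set} → Filt X → Set₁
Elt {X} F = Σ (Pred X 0ℓ) F

_≼_ : {X : Set} {F : Filt X} → Elt F → Elt F → Set
a ≼ b = proj₁ b ⊆ proj₁ a

Cofinal : {X : Set} (F : Filt X) → Pred (Elt F) (lsuc 0ℓ) → Set₁
Cofinal F C = ∀ (a : Elt F) → ∃[ c ] (C c × (_≼_ {F = F} a c))

Image : {X Y : Set} {P : Filt X} {Q : Filt Y} →
        (Elt Q → Elt P) → Pred (Elt Q) (lsuc 0ℓ) → Pred (Elt P) (lsuc 0ℓ)
Image f C p = ∃[ q ] (C q × f q ≡ p)

_≤T_ : {X Y : Set} → Filt X → Filt Y → Set₂
_≤T_ {X} {Y} P Q = Σ (Elt Q → Elt P) λ f →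
  ∀ (C : Pred (Elt Q) (lsuc 0ℓ)) → Cofinal Q C → Cofinal P (Image {P = P} {Q = Q} f C)

_≡T_ : {X Y : Set} → Filt X → Filt Y → Set₂
P ≡T Q = (P ≤T Q) × (Q ≤T P)

{-# OPTIONS --safe #-}
-- For any ultrafilters, B ↦ {p : B_p ∈ V} is monotone with cofinal image, so W ≤T W·V.
-- Conversely, for W = U_{min,max} the map A ↦ {(p, q) ∈ A² : p ⋖ r ⋖ q for some r ∈ A}, where
-- p ⋖ r means max p < min r, is monotone into W·W, and the Milliken–Taylor properties make it
-- cofinal. Given B ∈ W·W, the sets E n of x whose (min x, max x) lies in every W-large section
-- B_(a,b) with a, b ≤ n belong to U. Refining block sequences into E 0, E 1, … and diagonalising
-- gives Y and thresholds m n such that every z ∈ [Y] with min z > m n lies in E n. Let A be the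
-- (min, max)-image of those x ∈ [Y] with W-large section whose max exceeds m i for all i < min x
-- (a U-large condition). For x ⋖ z ⋖ y among them, z pushes min y past m (max x), hence
-- y ∈ E (max x) and ((min x, max x), (min y, max y)) ∈ B.

module Submission where

open import Defs
open import Axiom.ExcludedMiddle using (ExcludedMiddle)
open import Level using (0ℓ)
open import Function using (id; _∘_)
open import Data.Nat hiding (_/_)
open import Data.Nat.Properties
open import Data.Product
open import Data.Sum using (_⊎_; inj₁; inj₂)
open import Data.Empty using (⊥-elim)
open import Data.List using (List; []; _∷_; _++_; [_]; filter; upTo; initLast; _∷ʳ′_)
open import Data.List.NonEmpty as List⁺ using (List⁺; _∷_)
open import Data.List.Relation.Unary.Linked as Linked using (Linked; [-]; _∷_)
open import Data.List.Relation.Unary.Linked.Properties using (Linked⇒AllPairs; filter⁺; applyUpTo⁺₂; map⁺)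
import Data.List.Relation.Unary.All as All
open import Data.List.Relation.Unary.AllPairs using (AllPairs; _∷_)
open import Data.List.Relation.Unary.Any using (here; there)
open import Data.List.Membership.Propositional using (_∈_)
open import Data.List.Membership.Propositional.Properties
  using (∈-++⁺ʳ; ∈-++⁻; ∈-map⁺; ∈-map⁻; ∈-filter⁺; ∈-filter⁻; ∈-upTo⁺; ∈-upTo⁻)
open import Data.List.Membership.DecPropositional _≟_ using (_∈?_)
open import Relation.Nullary using (Dec; yes; no; ¬_)
open import Relation.Nullary.Decidable using (_⊎-dec_)
open import Relation.Unary using (Pred; Decidable; _⊆_; _∩_)
open import Relation.Binary.PropositionalEquality using (_≡_; refl; subst; sym)

AllPairs-∷ʳ⇒R-last : ∀ {A : Set} {R : A → A → Set} ys {z y} → AllPairs R (ys ++ [ z ]) → y ∈ ys → R y z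
AllPairs-∷ʳ⇒R-last (_ ∷ ys) (Ry ∷ _) (here refl) = All.lookup Ry (∈-++⁺ʳ ys (here refl))
AllPairs-∷ʳ⇒R-last (_ ∷ ys) (_ ∷ R-ys) (there y∈) = AllPairs-∷ʳ⇒R-last ys R-ys y∈

toList≡init++last : ∀ {A : Set} (l : List⁺ A) → ∃[ ys ] (List⁺.toList l ≡ ys ++ [ List⁺.last l ])
toList≡init++last (x ∷ xs) with initLast xs
... | []       = [] , refl
... | ys ∷ʳ′ _ = x ∷ ys , refl

minF-∈ : ∀ x → minF x ∈F x
minF-∈ (mkFIN (_ ∷ _) _) = here refl

minF-≤ : ∀ x {k} → k ∈F x → minF x ≤ k
minF-≤ (mkFIN (_ ∷ _) _)    (here refl) = ≤-refl
minF-≤ (mkFIN (_ ∷ _) incr) (there k∈)  with Linked⇒AllPairs <-trans incr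
... | head<tail ∷ _ = <⇒≤ (All.lookup head<tail k∈)

maxF-∈ : ∀ x → maxF x ∈F x
maxF-∈ (mkFIN l _) with toList≡init++last l
... | ys , eq = subst (_ ∈_) (sym eq) (∈-++⁺ʳ ys (here refl))

maxF-≥ : ∀ x {k} → k ∈F x → k ≤ maxF x
maxF-≥ (mkFIN l incr) k∈ with toList≡init++last l
... | ys , eq with ∈-++⁻ ys (subst (_ ∈_) eq k∈)
...   | inj₁ k∈ys =
  <⇒≤ (AllPairs-∷ʳ⇒R-last ys (Linked⇒AllPairs <-trans (subst (Linked _<_) eq incr)) k∈ys)
...   | inj₂ (here refl) = ≤-refl

minF≤maxF : ∀ x → minF x ≤ maxF x
minF≤maxF x = maxF-≥ x (minF-∈ x)

_∈F?_ : ∀ k x → Dec (k ∈F x)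
k ∈F? x = k ∈? List⁺.toList (FIN.elems x)

fromList : ∀ {w} (xs : List ℕ) → Linked _<_ xs → w ∈ xs → FIN
fromList []       _    ()
fromList (x ∷ xs) incr _ = mkFIN (x ∷ xs) incr

∈F-fromList⁻ : ∀ {w k} xs incr (w∈ : w ∈ xs) → k ∈F fromList xs incr w∈ → k ∈ xs
∈F-fromList⁻ (_ ∷ _) _ _ k∈ = k∈

∈F-fromList⁺ : ∀ {w k} xs incr (w∈ : w ∈ xs) → k ∈ xs → k ∈F fromList xs incr w∈
∈F-fromList⁺ (_ ∷ _) _ _ k∈ = k∈

-- finOf N w<N pw is {k < N | P k}; the witness w makes it nonempty.
module _ {P : Pred ℕ 0ℓ} (P? : Decidable P) where

  private
    upTo-incr : ∀ N → Linked _<_ (upTo N)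
    upTo-incr N = applyUpTo⁺₂ id N n<1+n

    members : ℕ → List ℕ
    members N = filter P? (upTo N)

  finOf : ∀ N {w} → w < N → P w → FIN
  finOf N w<N pw =
    fromList (members N) (filter⁺ P? <-trans (upTo-incr N)) (∈-filter⁺ P? (∈-upTo⁺ w<N) pw)

  ∈-finOf⁻ : ∀ N {w} (w<N : w < N) (pw : P w) {k} → k ∈F finOf N w<N pw → k < N × P k
  ∈-finOf⁻ N w<N pw k∈ with ∈-filter⁻ P? (∈F-fromList⁻ (members N) _ _ k∈)
  ... | k∈upTo , pk = ∈-upTo⁻ k∈upTo , pk

  ∈-finOf⁺ : ∀ N {w} (w<N : w < N) (pw : P w) {k} → k < N → P k → k ∈F finOf N w<N pw
  ∈-finOf⁺ N w<N pw k<N pk = ∈F-fromList⁺ (members N) _ _ (∈-filter⁺ P? (∈-upTo⁺ k<N) pk)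

  least : ∀ {w} → P w → ∃[ n ] (P n × (∀ k → k < n → ¬ P k))
  least {w} pw = minF s , proj₂ (∈-finOf⁻ (suc w) ≤-refl pw (minF-∈ s)) , below
    where
    s : FIN
    s = finOf (suc w) ≤-refl pw
    below : ∀ k → k < minF s → ¬ P k
    below k k<min pk = <⇒≱ k<min (minF-≤ s (∈-finOf⁺ (suc w) ≤-refl pw k<1+w pk))
      where
      k<1+w : k < suc w
      k<1+w = m<n⇒m<1+n (<-≤-trans k<min (minF-≤ s (∈-finOf⁺ (suc w) ≤-refl pw ≤-refl pw)))

index≤minF : ∀ {X} → IsBlock X → ∀ i → i ≤ minF (X i)
index≤minF bX zero = z≤n
index≤minF {X} bX (suc i) =
  ≤-<-trans (≤-trans (index≤minF {X} bX i) (minF≤maxF (X i))) (bX i (suc i) ≤-refl)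

InBlocks : (ℕ → FIN) → FIN → Pred ℕ 0ℓ
InBlocks X F k = ∃[ i ] (i ∈F F × k ∈F X i)

UnionOver : (ℕ → FIN) → FIN → FIN → Set
UnionOver X F s = ∀ k → (k ∈F s → InBlocks X F k) × (InBlocks X F k → k ∈F s)

⟦⟧-single : ∀ X i → ⟦ X ⟧ (X i)
⟦⟧-single X i = mkFIN (i ∷ []) [-] , λ k → (λ k∈ → i , here refl , k∈) , λ { (_ , here refl , k∈) → k∈ }

⟦⟧-pair : ∀ X {i j} → i < j → ∃[ s ] (⟦ X ⟧ s × minF s ≤ minF (X i) × maxF (X j) ≤ maxF s)
⟦⟧-pair X {i} {j} i<j = s , (ij , spec)
                      , minF-≤ s (∈s (inj₁ (minF-∈ (X i)))) , maxF-≥ s (∈s (inj₂ (maxF-∈ (X j))))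
  where
  ij : FIN
  ij = mkFIN (i ∷ j ∷ []) (i<j ∷ [-])
  P : Pred ℕ 0ℓ
  P k = k ∈F X i ⊎ k ∈F X j
  N : ℕ
  N = suc (maxF (X i) ⊔ maxF (X j))
  bound : ∀ {k} → P k → k < N
  bound (inj₁ k∈) = s≤s (≤-trans (maxF-≥ (X i) k∈) (m≤m⊔n _ _))
  bound (inj₂ k∈) = s≤s (≤-trans (maxF-≥ (X j) k∈) (m≤n⊔m _ _))
  w∈ : P (minF (X i))
  w∈ = inj₁ (minF-∈ (X i))
  P? : Decidable P
  P? k = k ∈F? X i ⊎-dec k ∈F? X j
  s : FIN
  s = finOf P? N (bound w∈) w∈
  ∈s : ∀ {k} → P k → k ∈F s
  ∈s pk = ∈-finOf⁺ P? N (bound w∈) w∈ (bound pk) pk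
  spec : UnionOver X ij s
  spec k = to , from
    where
    to : k ∈F s → InBlocks X ij k
    to k∈ with proj₂ (∈-finOf⁻ P? N (bound w∈) w∈ k∈)
    ... | inj₁ k∈i = i , here refl , k∈i
    ... | inj₂ k∈j = j , there (here refl) , k∈j
    from : InBlocks X ij k → k ∈F s
    from (_ , here refl , k∈i)         = ∈s (inj₁ k∈i)
    from (_ , there (here refl) , k∈j) = ∈s (inj₂ k∈j)

⟦shift⟧⊆⟦⟧ : ∀ X n → ⟦ shift X n ⟧ ⊆ ⟦ X ⟧
⟦shift⟧⊆⟦⟧ X n (mkFIN (i₀ ∷ is) incr , spec) = shifted , λ k → to ∘ proj₁ (spec k) , proj₂ (spec k) ∘ from
  where
  shifted : FIN
  shifted = mkFIN (List⁺.map (n +_) (i₀ ∷ is)) (map⁺ (Linked.map (+-monoʳ-< n) incr))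
  to : InBlocks (shift X n) (mkFIN (i₀ ∷ is) incr) ⊆ InBlocks X shifted
  to (i , i∈ , k∈) = n + i , ∈-map⁺ (n +_) i∈ , k∈
  from : InBlocks X shifted ⊆ InBlocks (shift X n) (mkFIN (i₀ ∷ is) incr)
  from (_ , j∈ , k∈) with ∈-map⁻ (n +_) j∈
  ... | i , i∈ , refl = i , i∈ , k∈

⟦⟧-unshift : ∀ X n {s} F → n ≤ minF F → UnionOver X F s → ⟦ shift X n ⟧ s
⟦⟧-unshift X n F n≤F spec = G , λ k → to ∘ proj₁ (spec k) , proj₂ (spec k) ∘ from
  where
  n≤ : ∀ {i} → i ∈F F → n ≤ i
  n≤ i∈ = ≤-trans n≤F (minF-≤ F i∈)
  P : Pred ℕ 0ℓ
  P j = (n + j) ∈F F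
  w∈ : P (minF F ∸ n)
  w∈ = subst (_∈F F) (sym (m+[n∸m]≡n n≤F)) (minF-∈ F)
  bound : ∀ {i} → i ∈F F → i ∸ n < suc (maxF F)
  bound i∈ = s≤s (≤-trans (m∸n≤m _ n) (maxF-≥ F i∈))
  P? : Decidable P
  P? j = (n + j) ∈F? F
  w<N : minF F ∸ n < suc (maxF F)
  w<N = bound (minF-∈ F)
  G : FIN
  G = finOf P? (suc (maxF F)) w<N w∈
  to : InBlocks X F ⊆ InBlocks (shift X n) G
  to {k} (i , i∈ , k∈) = i ∸ n
                      , ∈-finOf⁺ P? (suc (maxF F)) w<N w∈ (bound i∈) (subst (_∈F F) (sym n+[i∸n]≡i) i∈)
                      , subst (λ t → k ∈F X t) (sym n+[i∸n]≡i) k∈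
    where
    n+[i∸n]≡i : n + (i ∸ n) ≡ i
    n+[i∸n]≡i = m+[n∸m]≡n (n≤ i∈)
  from : InBlocks (shift X n) G ⊆ InBlocks X F
  from (j , j∈ , k∈) = n + j , proj₂ (∈-finOf⁻ P? (suc (maxF F)) w<N w∈ j∈) , k∈

⟦/⟧⊆⟦⟧ : ∀ X m → ⟦ X / m ⟧ ⊆ ⟦ X ⟧
⟦/⟧⊆⟦⟧ X m {s} (n , _ , s∈) = ⟦shift⟧⊆⟦⟧ X n {s} s∈

⊆⇒≤* : ∀ {X Y} → ⟦ Y ⟧ ⊆ ⟦ X ⟧ → Y ≤* X
⊆⇒≤* {Y = Y} Y⊆X = 0 , λ {s} s∈ → Y⊆X {s} (⟦/⟧⊆⟦⟧ Y 0 {s} s∈)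

⟦⟧⇒⟦/⟧ : ∀ {X} → IsBlock X → ∀ m {z} → ⟦ X ⟧ z → m < minF z → ⟦ X / m ⟧ z
⟦⟧⇒⟦/⟧ {X} bX m {z} (F , spec) m<z with least (λ i → m <? minF (X i)) (index≤minF {X} bX (suc m))
... | n , m<Xn , before = n , (m<Xn , λ k k<n → ≮⇒≥ (before k k<n))
                        , ⟦⟧-unshift X n {z} F (≮⇒≥ first-index-late) spec
  where
  first-index-late : ¬ minF F < n
  first-index-late F<n = before (minF F) F<n
    (<-≤-trans m<z (minF-≤ z (proj₂ (spec _) (minF F , minF-∈ F , minF-∈ (X (minF F))))))

finiteBound : ∀ (f : ℕ → ℕ) N → ∃[ b ] (∀ i → i < N → f i < b)
finiteBound f zero    = 0 , λ _ ()
finiteBound f (suc N) with finiteBound f N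
... | b , below = b ⊔ suc (f N) , bound
  where
  bound : ∀ i → i < suc N → f i < b ⊔ suc (f N)
  bound i i<1+N with m<1+n⇒m<n∨m≡n i<1+N
  ... | inj₁ i<N  = m<n⇒m<n⊔o (suc (f N)) (below i i<N)
  ... | inj₂ refl = m<n⇒m<o⊔n b ≤-refl

monotone-cofinal⇒≤T : {X Y : Set} {P : Filt X} {Q : Filt Y} (f : Elt Q → Elt P) →
                      (∀ a b → proj₁ b ⊆ proj₁ a → proj₁ (f b) ⊆ proj₁ (f a)) →
                      (∀ p → ∃[ q ] (proj₁ (f q) ⊆ proj₁ p)) → P ≤T Q
monotone-cofinal⇒≤T f mono cof = f , λ C C-cofinal p →
  let q , fq⊆p = cof p
      c , c∈C , c⊆q = C-cofinal q
  in f c , (c , c∈C , refl) , λ x∈ → fq⊆p (mono q c c⊆q x∈)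

module _ {X : Set} {U : Filt X} (U-ultra : IsUltrafilter U) where
  open IsUltrafilter U-ultra

  U-⋂≤ : ∀ {A : ℕ → Pred X 0ℓ} → (∀ i → U (A i)) → ∀ n → U (λ x → ∀ i → i ≤ n → A i x)
  U-⋂≤ UA zero    = upward (λ A₀ → λ { _ z≤n → A₀ }) (UA 0)
  U-⋂≤ {A} UA (suc n) = upward extend (inter (U-⋂≤ UA n) (UA (suc n)))
    where
    extend : ∀ {x} → (∀ i → i ≤ n → A i x) × A (suc n) x → ∀ i → i ≤ suc n → A i x
    extend (below , A₁₊ₙ) i i≤1+n with m≤n⇒m<n∨m≡n i≤1+n
    ... | inj₁ i<1+n = below i (s≤s⁻¹ i<1+n)
    ... | inj₂ refl  = A₁₊ₙ

  module _ (lem : ∀ {a} → ExcludedMiddle a) where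

    U-nonempty : ∀ {A} → U A → ∃[ x ] A x
    U-nonempty {A} UA with lem {P = ∃[ x ] A x}
    ... | yes x∈A = x∈A
    ... | no  A≡∅ = ⊥-elim (proper (upward (λ {x} x∈A → A≡∅ (x , x∈A)) UA))

    U-guard : ∀ {A : Pred X 0ℓ} (P : Set) → (P → U A) → U (λ x → P → A x)
    U-guard P UA with lem {P = P}
    ... | yes p = upward (λ x∈A _ → x∈A) (UA p)
    ... | no ¬p = upward (λ _ p → ⊥-elim (¬p p)) full

Uminmax-isUltrafilter : ∀ {U} → IsUltrafilter U → IsUltrafilter (Uminmax U)
Uminmax-isUltrafilter U-ultra = record
  { upward = λ A⊆B → upward A⊆B
  ; inter  = inter
  ; full   = full
  ; proper = proper
  ; ultra  = λ A → ultra (λ x → A (minF x , maxF x))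
  }
  where open IsUltrafilter U-ultra

≤T-· : (∀ {a} → ExcludedMiddle a) → {X Y : Set} {W : Filt X} {V : Filt Y} →
       IsUltrafilter W → IsUltrafilter V → W ≤T (W · V)
≤T-· lem {W = W} {V} W-ultra V-ultra = monotone-cofinal⇒≤T sections mono cofinal
  where
  module W = IsUltrafilter W-ultra
  module V = IsUltrafilter V-ultra
  sections : Elt (W · V) → Elt W
  sections (B , WVB) = (λ p → V (λ q → B (p , q))) , WVB
  mono : ∀ a b → proj₁ b ⊆ proj₁ a → proj₁ (sections b) ⊆ proj₁ (sections a)
  mono _ _ b⊆a = V.upward b⊆a
  cofinal : ∀ p → ∃[ q ] (proj₁ (sections q) ⊆ proj₁ p)
  cofinal (A , WA) = ((λ pq → A (proj₁ pq)) , W.upward (λ p∈A → V.upward (λ _ → p∈A) V.full) WA)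
                   , λ V-const → proj₂ (U-nonempty V-ultra lem V-const)

module _ {U : Filt FIN} (mt : IsMillikenTaylor U) where
  open IsMillikenTaylor mt
  open IsUltrafilter ultrafilter

  meets-every-⟦⟧⇒U : ∀ {A} → (∀ X → IsBlock X → ∃[ s ] (⟦ X ⟧ s × A s)) → U A
  meets-every-⟦⟧⇒U {A} meets with ultra A
  ... | inj₁ UA  = UA
  ... | inj₂ U∁A with mt1 _ U∁A
  ...   | X , bX , ⟦X⟧⊆∁A , _ with meets X bX
  ...     | s , s∈⟦X⟧ , s∈A = ⊥-elim (⟦X⟧⊆∁A s∈⟦X⟧ s∈A)

  U-minF> : ∀ k → U (λ x → k < minF x)
  U-minF> k = meets-every-⟦⟧⇒U λ X bX → X (suc k) , ⟦⟧-single X (suc k) , index≤minF {X} bX (suc k)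

  U-spread : ∀ (f : ℕ → ℕ) → U (λ x → ∀ i → i < minF x → f i < maxF x)
  U-spread f = meets-every-⟦⟧⇒U spread
    where
    spread : ∀ X → IsBlock X → ∃[ s ] (⟦ X ⟧ s × (∀ i → i < minF s → f i < maxF s))
    spread X bX with finiteBound f (minF (X 0))
    ... | b , below with ⟦⟧-pair X {0} {suc b} z<s
    ...   | s , s∈⟦X⟧ , s≤X₀ , Xₙ≤s = s , s∈⟦X⟧ , λ i i<s →
      <-≤-trans (below i (<-≤-trans i<s s≤X₀))
        (≤-trans (<⇒≤ (index≤minF {X} bX (suc b))) (≤-trans (minF≤maxF (X (suc b))) Xₙ≤s))

  record BlocksInside (A : Pred FIN 0ℓ) : Set where
    field
      blocks   : ℕ → FIN
      isBlock  : IsBlock blocks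
      ⟦⟧⊆      : ⟦ blocks ⟧ ⊆ A
      large    : U ⟦ blocks ⟧

  blocksInside : ∀ {A} → U A → BlocksInside A
  blocksInside UA with mt1 _ UA
  ... | X , bX , ⟦X⟧⊆A , U⟦X⟧ = record { blocks = X ; isBlock = bX ; ⟦⟧⊆ = ⟦X⟧⊆A ; large = U⟦X⟧ }

  record Diagonalisation (E : ℕ → Pred FIN 0ℓ) : Set where
    field
      Y             : ℕ → FIN
      Y-isBlock     : IsBlock Y
      U⟦Y⟧          : U ⟦ Y ⟧
      threshold     : ℕ → ℕ
      ⟦Y⟧-eventually : ∀ n {z} → ⟦ Y ⟧ z → threshold n < minF z → E n z

  MT-diagonal : ∀ (E : ℕ → Pred FIN 0ℓ) → (∀ n → U (E n)) → Diagonalisation E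
  MT-diagonal E UE = record
    { Y = Y ; Y-isBlock = bY ; U⟦Y⟧ = U⟦Y⟧ ; threshold = m
    ; ⟦Y⟧-eventually = λ n {z} z∈⟦Y⟧ m<z →
        ⟦⟧⊆ (chain n) {z} (proj₂ (Y≤* n) {z} (⟦⟧⇒⟦/⟧ {Y} bY (m n) {z} z∈⟦Y⟧ m<z))
    }
    where
    open BlocksInside
    chain : ∀ n → BlocksInside (E n)
    refine : ∀ n → BlocksInside (E (suc n) ∩ ⟦ blocks (chain n) ⟧)
    chain zero    = blocksInside (UE 0)
    chain (suc n) = record { BlocksInside (refine n) ; ⟦⟧⊆ = λ {s} s∈ → proj₁ (⟦⟧⊆ (refine n) {s} s∈) }
    refine n      = blocksInside (inter (UE (suc n)) (large (chain n)))

    nested : ∀ n → blocks (chain (suc n)) ≤* blocks (chain n)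
    nested n = ⊆⇒≤* {blocks (chain n)} {blocks (chain (suc n))} λ {s} s∈ → proj₂ (⟦⟧⊆ (refine n) {s} s∈)

    diagonal : ∃[ Y ] (IsBlock Y × U ⟦ Y ⟧ × (∀ n → Y ≤* blocks (chain n)))
    diagonal = mt2 (blocks ∘ chain) (isBlock ∘ chain) nested (large ∘ chain)
    Y : ℕ → FIN
    Y = proj₁ diagonal
    bY : IsBlock Y
    bY = proj₁ (proj₂ diagonal)
    U⟦Y⟧ : U ⟦ Y ⟧
    U⟦Y⟧ = proj₁ (proj₂ (proj₂ diagonal))
    Y≤* : ∀ n → Y ≤* blocks (chain n)
    Y≤* = proj₂ (proj₂ (proj₂ diagonal))
    m : ℕ → ℕ
    m n = proj₁ (Y≤* n)

_⋖_ : ℕ × ℕ → ℕ × ℕ → Set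
p ⋖ q = proj₂ p < proj₁ q

separatedPairs : Pred (ℕ × ℕ) 0ℓ → Pred ((ℕ × ℕ) × (ℕ × ℕ)) 0ℓ
separatedPairs A (p , q) = A p × A q × ∃[ r ] (A r × p ⋖ r × r ⋖ q)

separatedPairs-mono : ∀ {A A′} → A ⊆ A′ → separatedPairs A ⊆ separatedPairs A′
separatedPairs-mono A⊆A′ (p∈A , q∈A , r , r∈A , p⋖r , r⋖q) =
  A⊆A′ p∈A , A⊆A′ q∈A , r , A⊆A′ r∈A , p⋖r , r⋖q

module _ (lem : ∀ {a} → ExcludedMiddle a) {U : Filt FIN} (mt : IsMillikenTaylor U) where
  open IsMillikenTaylor mt using (ultrafilter)
  open IsUltrafilter ultrafilter

  private
    W : Filt (ℕ × ℕ)
    W = Uminmax U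

    mm : FIN → ℕ × ℕ
    mm x = minF x , maxF x

  separatedPairs-large : ∀ {A} → W A → (W · W) (separatedPairs A)
  separatedPairs-large {A} WA = upward (λ {x} → pairs-from x) WA
    where
    after : ∀ k → U (λ y → A (mm y) × k < minF y)
    after k = inter WA (U-minF> mt k)
    pairs-from : ∀ x → A (mm x) → U (λ y → separatedPairs A (mm x , mm y))
    pairs-from x x∈A with U-nonempty ultrafilter lem (after (maxF x))
    ... | z , z∈A , x⋖z = upward (λ { (y∈A , z⋖y) → x∈A , y∈A , mm z , z∈A , x⋖z , z⋖y })
                                  (after (maxF z))

  InLargeSections : Pred ((ℕ × ℕ) × (ℕ × ℕ)) 0ℓ → ℕ → Pred FIN 0ℓ
  InLargeSections B n x = ∀ a → a ≤ n → ∀ b → b ≤ n → W (λ q → B ((a , b) , q)) → B ((a , b) , mm x)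

  U-InLargeSections : ∀ B n → U (InLargeSections B n)
  U-InLargeSections B n = U-⋂≤ ultrafilter (λ a → U-⋂≤ ultrafilter (λ b → U-guard ultrafilter lem _ id) n) n

  separatedPairs-cofinal : ∀ {B} → (W · W) B → ∃[ A ] (W A × separatedPairs A ⊆ B)
  separatedPairs-cofinal {B} WWB = A , upward (λ {x} x∈S → x , x∈S , refl) US , sep⊆B
    where
    open Diagonalisation (MT-diagonal mt (InLargeSections B) (U-InLargeSections B))
    S : Pred FIN 0ℓ
    S x = ⟦ Y ⟧ x × (∀ i → i < minF x → threshold i < maxF x) × W (λ q → B (mm x , q))
    US : U S
    US = inter U⟦Y⟧ (inter (U-spread mt threshold) WWB)
    A : Pred (ℕ × ℕ) 0ℓ
    A p = ∃[ x ] (S x × mm x ≡ p)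
    sep⊆B : separatedPairs A ⊆ B
    sep⊆B ((x , (_ , _ , x∈G) , refl) , (y , (y∈⟦Y⟧ , _) , refl) ,
           _ , (z , (_ , z-spread , _) , refl) , x⋖z , z⋖y) =
      ⟦Y⟧-eventually (maxF x) {y} y∈⟦Y⟧ (<-trans (z-spread (maxF x) x⋖z) z⋖y)
        (minF x) (minF≤maxF x) (maxF x) ≤-refl x∈G

  W·W≤TW : (W · W) ≤T W
  W·W≤TW = monotone-cofinal⇒≤T (λ (A , WA) → separatedPairs A , separatedPairs-large WA)
                               (λ _ _ A⊆A′ → separatedPairs-mono A⊆A′)
                               (λ (B , WWB) → let A , WA , sep⊆B = separatedPairs-cofinal WWB
                                              in (A , WA) , sep⊆B)

corollary4p8 : (lem : ∀ {a} → ExcludedMiddle a) →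
    (U : Filt FIN) → IsMillikenTaylor U →
    Uminmax U ≡T (Uminmax U · Uminmax U)
corollary4p8 lem U mt = ≤T-· lem W-ultra W-ultra , W·W≤TW lem mt
  where
  W-ultra : IsUltrafilter (Uminmax U)
  W-ultra = Uminmax-isUltrafilter (IsMillikenTaylor.ultrafilter mt)
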